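{- Let $\pi:\operatorname{SL}(2,\mathbb{Z}_3)\to\operatorname{SL}(2,\mathbb{F}_3)$ be the homomorphism given by reducing entries modulo $3$. There exists an injective group homomorphism $\beta:\operatorname{SL}(2,\mathbb{F}_3)\hookrightarrow\operatorname{SL}(2,\mathbb{Z}_3)$ such that $\pi\circ\beta$ is the identity map of $\operatorname{SL}(2,\mathbb{F}_3)$. The same statement holds with $\operatorname{SL}(2)$ replaced everywhere by $\operatorname{GL}(2)$.
   Context: $\mathbb{Z}_3$ is the ring of $3$-adic integers and $\mathbb{F}_3$ the field with three elements. -}

module Defs where

open import Data.Nat as ℕ using (ℕ; zero; suc)
open import Data.Fin as Fin using (Fin; toℕ)
open import Data.Nat.DivMod using (_mod_)
open import Data.Integer as ℤ using (ℤ; +_; _%ℕ_)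
open import Data.Integer.Divisibility.Signed
  using (_∣_; ∣m∣n⇒∣m+n; ∣m∣n⇒∣m-n; ∣m⇒∣-m; ∣n⇒∣m*n; ∣m⇒∣m*n; divides)
open import Data.Integer.Tactic.RingSolver using (solve-∀)
open import Relation.Binary.PropositionalEquality using (_≡_; refl; subst; sym)
open import Data.Product using (Σ; ∃; _×_; _,_; proj₁)
open import Relation.Nullary using (¬_)

𝔽₃ : Set
𝔽₃ = Fin 3

infixl 6 _+₃_ _-₃_
infixl 7 _*₃_

_+₃_ : 𝔽₃ → 𝔽₃ → 𝔽₃
a +₃ b = (toℕ a ℕ.+ toℕ b) mod 3

_*₃_ : 𝔽₃ → 𝔽₃ → 𝔽₃
a *₃ b = (toℕ a ℕ.* toℕ b) mod 3

_-₃_ : 𝔽₃ → 𝔽₃ → 𝔽₃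
a -₃ b = (toℕ a ℕ.+ 2 ℕ.* toℕ b) mod 3

-- The 3-adic integers ℤ₃ = lim ℤ/3ⁿℤ, represented as coherent sequences
-- of integers (x n represents a class mod 3ⁿ; x (n+1) ≡ x n mod 3ⁿ),
-- with equality ≈ : agreement mod 3ⁿ for every n.

_≡_[mod3^_] : ℤ → ℤ → ℕ → Set
a ≡ b [mod3^ n ] = (+ (3 ℕ.^ n)) ∣ (a ℤ.- b)

record ℤ₃ : Set where
  constructor mkℤ₃
  field
    seq : ℕ → ℤ
    coh : ∀ n → seq (suc n) ≡ seq n [mod3^ n ]
open ℤ₃ public

infix 4 _≈₃_
_≈₃_ : ℤ₃ → ℤ₃ → Set
x ≈₃ y = ∀ n → seq x n ≡ seq y n [mod3^ n ]

private
  id+ : ∀ a b c d → (a ℤ.+ b) ℤ.- (c ℤ.+ d) ≡ (a ℤ.- c) ℤ.+ (b ℤ.- d)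
  id+ = solve-∀
  id- : ∀ a b c d → (a ℤ.- b) ℤ.- (c ℤ.- d) ≡ (a ℤ.- c) ℤ.- (b ℤ.- d)
  id- = solve-∀
  id* : ∀ a b c d → (a ℤ.* b) ℤ.- (c ℤ.* d) ≡ a ℤ.* (b ℤ.- d) ℤ.+ (a ℤ.- c) ℤ.* d
  id* = solve-∀

infixl 6 _+ₚ_ _-ₚ_
infixl 7 _*ₚ_

_+ₚ_ : ℤ₃ → ℤ₃ → ℤ₃
x +ₚ y = mkℤ₃ (λ n → seq x n ℤ.+ seq y n)
  (λ n → subst (_ ∣_) (sym (id+ (seq x (suc n)) (seq y (suc n)) (seq x n) (seq y n)))
           (∣m∣n⇒∣m+n (coh x n) (coh y n)))

_-ₚ_ : ℤ₃ → ℤ₃ → ℤ₃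
x -ₚ y = mkℤ₃ (λ n → seq x n ℤ.- seq y n)
  (λ n → subst (_ ∣_) (sym (id- (seq x (suc n)) (seq y (suc n)) (seq x n) (seq y n)))
           (∣m∣n⇒∣m-n (coh x n) (coh y n)))

_*ₚ_ : ℤ₃ → ℤ₃ → ℤ₃
x *ₚ y = mkℤ₃ (λ n → seq x n ℤ.* seq y n)
  (λ n → subst (_ ∣_) (sym (id* (seq x (suc n)) (seq y (suc n)) (seq x n) (seq y n)))
           (∣m∣n⇒∣m+n (∣n⇒∣m*n (seq x (suc n)) (coh y n)) (∣m⇒∣m*n (seq y n) (coh x n))))

private
  idc : ∀ c k → c ℤ.- c ≡ + 0 ℤ.* k
  idc = solve-∀

const : ℤ → ℤ₃
const c = mkℤ₃ (λ _ → c) (λ n → divides (+ 0) (idc c (+ (3 ℕ.^ n))))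

0ₚ 1ₚ : ℤ₃
0ₚ = const (+ 0)
1ₚ = const (+ 1)

red : ℤ₃ → 𝔽₃
red x = (seq x 1 %ℕ 3) mod 3

record M2 (A : Set) : Set where
  constructor mat
  field a b c d : A
open M2 public

map2 : {A B : Set} → (A → B) → M2 A → M2 B
map2 f (mat a b c d) = mat (f a) (f b) (f c) (f d)

det₃ : M2 𝔽₃ → 𝔽₃
det₃ (mat a b c d) = (a *₃ d) -₃ (b *₃ c)

_·₃_ : M2 𝔽₃ → M2 𝔽₃ → M2 𝔽₃
mat a b c d ·₃ mat a' b' c' d' =
  mat (a *₃ a' +₃ b *₃ c') (a *₃ b' +₃ b *₃ d')
      (c *₃ a' +₃ d *₃ c') (c *₃ b' +₃ d *₃ d')

detₚ : M2 ℤ₃ → ℤ₃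
detₚ (mat a b c d) = (a *ₚ d) -ₚ (b *ₚ c)

_·ₚ_ : M2 ℤ₃ → M2 ℤ₃ → M2 ℤ₃
mat a b c d ·ₚ mat a' b' c' d' =
  mat (a *ₚ a' +ₚ b *ₚ c') (a *ₚ b' +ₚ b *ₚ d')
      (c *ₚ a' +ₚ d *ₚ c') (c *ₚ b' +ₚ d *ₚ d')

_≈ₘ_ : M2 ℤ₃ → M2 ℤ₃ → Set
mat a b c d ≈ₘ mat a' b' c' d' = (a ≈₃ a') × (b ≈₃ b') × (c ≈₃ c') × (d ≈₃ d')

π : M2 ℤ₃ → M2 𝔽₃
π = map2 red

SL2F3 : Set
SL2F3 = Σ (M2 𝔽₃) λ g → det₃ g ≡ Fin.suc Fin.zero

GL2F3 : Set
GL2F3 = Σ (M2 𝔽₃) λ g → ¬ (det₃ g ≡ Fin.zero)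

InSL2Z3 : M2 ℤ₃ → Set
InSL2Z3 g = detₚ g ≈₃ 1ₚ

InGL2Z3 : M2 ℤ₃ → Set
InGL2Z3 g = ∃ λ u → (detₚ g *ₚ u) ≈₃ 1ₚ

-- G is a subset {g | P g} of M₂(𝔽₃) closed under ·₃;
-- the homomorphism property is stated for all g, h, k ∈ G with k = g·h.

record SplittingHom {P : M2 𝔽₃ → Set} (InH : M2 ℤ₃ → Set)
                    (β : Σ (M2 𝔽₃) P → M2 ℤ₃) : Set where
  field
    lands     : ∀ g → InH (β g)
    hom       : ∀ (g h k : Σ (M2 𝔽₃) P) → proj₁ k ≡ proj₁ g ·₃ proj₁ h →
                β k ≈ₘ (β g ·ₚ β h)
    injective : ∀ (g h : Σ (M2 𝔽₃) P) → β g ≈ₘ β h → proj₁ g ≡ proj₁ h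
    section   : ∀ g → π (β g) ≡ proj₁ g

-- The finite group GL(2,𝔽₃) lifts to GL(2,ℤ[√-2]): an explicit lift, checked by
-- exhaustive computation, is multiplicative, sends determinant 1 to determinant 1,
-- and takes determinants ±1 on invertible matrices.  Since −2 ≡ 1 is a nonzero square mod 3,
-- Hensel's lemma gives a 3-adic square root of −2 congruent to 1, and sending √-2
-- to it is a ring homomorphism ℤ[√-2] → ℤ₃ that is compatible with reduction
-- mod 3.  Composing it with the lift gives β, and π ∘ β = id forces injectivity.

module Submission where

open import Defs
open import Data.Product using (Σ; _×_; _,_; proj₁; uncurry)
open import Data.Product.Properties using (≡-dec)
open import Data.Nat as ℕ using (ℕ; zero; suc; s≤s)
open import Data.Nat.DivMod using (_mod_)
open import Data.Integer as ℤ using (ℤ; +_; _%ℕ_; _/ℕ_)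
import Data.Integer.Literals as ℤLiterals
import Data.Nat.Literals as ℕLiterals
open import Data.Integer.Properties using (pos-*; *-comm; +-inverseʳ)
open import Data.Integer.DivMod using (n%ℕd<d; a≡a%ℕn+[a/ℕn]*n)
open import Data.Integer.Divisibility.Signed
  using (_∣_; divides; _∣?_; ∣-trans; ∣m∣n⇒∣m+n; ∣m∣n⇒∣m-n; ∣m⇒∣-m; ∣n⇒∣m*n; ∣m⇒∣m*n; *-monoʳ-∣; *-monoˡ-∣)
open import Data.Integer.Tactic.RingSolver using (solve-∀)
open import Data.Fin using (Fin; toℕ)
import Data.Fin as Fin
open import Data.Fin.Patterns using (0F; 1F; 2F)
open import Data.Fin.Properties using (all?; 0≢1+n)
open import Data.Unit using (tt)
open import Agda.Builtin.FromNat
open import Agda.Builtin.FromNeg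
open import Relation.Nullary using (Dec; ¬?; contradiction)
open import Relation.Nullary.Decidable using (from-yes; from-no; map′; _→-dec_; _×-dec_)
open import Relation.Unary using (Decidable)
open import Relation.Binary.Definitions using (DecidableEquality)
open import Relation.Binary.PropositionalEquality as ≡
  using (_≡_; _≢_; refl; cong; subst; subst₂)

instance
  ℕ-number : Number ℕ
  ℕ-number = ℕLiterals.number

  ℤ-number : Number ℤ
  ℤ-number = ℤLiterals.number

  ℤ-negative : Negative ℤ
  ℤ-negative = ℤLiterals.negative

∣-by : ∀ {k a b} → k ∣ a → a ≡ b → k ∣ b
∣-by {k} k∣a a≡b = subst (k ∣_) a≡b k∣a

3^_ : ℕ → ℤ
3^ n = + (3 ℕ.^ n)

3^-suc : ∀ n → 3^ suc n ≡ 3^ n ℤ.* 3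
3^-suc n = ≡.trans (pos-* 3 (3 ℕ.^ n)) (*-comm 3 (3^ n))

3^∣3^-suc : ∀ n → 3^ n ∣ 3^ suc n
3^∣3^-suc n = divides 3 (≡.trans (3^-suc n) (*-comm (3^ n) 3))

3∣3^-suc : ∀ n → 3 ∣ 3^ suc n
3∣3^-suc n = divides (3^ n) (3^-suc n)

-- _≈₃_ unfolds to a function space from which Agda cannot recover the two
-- 3-adic integers; wrapping it in a record makes them inferable.
infix 4 _≃ₚ_
record _≃ₚ_ (x y : ℤ₃) : Set where
  constructor ≈₃⇒≃ₚ
  field ≃ₚ⇒≈₃ : x ≈₃ y
open _≃ₚ_

seq-≡⇒≃ₚ : ∀ {x y} → (∀ n → seq x n ≡ seq y n) → x ≃ₚ y
seq-≡⇒≃ₚ {x} eq = ≈₃⇒≃ₚ λ n →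
  subst (λ z → _ ∣ seq x n ℤ.- z) (eq n) (divides 0 (+-inverseʳ (seq x n)))

≃ₚ-refl : ∀ {x} → x ≃ₚ x
≃ₚ-refl = seq-≡⇒≃ₚ λ _ → refl

≡⇒≃ₚ : ∀ {x y} → x ≡ y → x ≃ₚ y
≡⇒≃ₚ refl = ≃ₚ-refl

≃ₚ-sym : ∀ {x y} → x ≃ₚ y → y ≃ₚ x
≃ₚ-sym {x} {y} (≈₃⇒≃ₚ x≈y) = ≈₃⇒≃ₚ λ n → ∣-by (∣m⇒∣-m (x≈y n)) (negate-diff (seq x n) (seq y n))
  where
  negate-diff : ∀ a b → ℤ.- (a ℤ.- b) ≡ b ℤ.- a
  negate-diff = solve-∀

≃ₚ-trans : ∀ {x y z} → x ≃ₚ y → y ≃ₚ z → x ≃ₚ z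
≃ₚ-trans {x} {y} {z} (≈₃⇒≃ₚ x≈y) (≈₃⇒≃ₚ y≈z) = ≈₃⇒≃ₚ λ n →
  ∣-by (∣m∣n⇒∣m+n (x≈y n) (y≈z n)) (telescope (seq x n) (seq y n) (seq z n))
  where
  telescope : ∀ a b c → (a ℤ.- b) ℤ.+ (b ℤ.- c) ≡ a ℤ.- c
  telescope = solve-∀

+ₚ-cong : ∀ {x x' y y'} → x ≃ₚ x' → y ≃ₚ y' → x +ₚ y ≃ₚ x' +ₚ y'
+ₚ-cong {x} {x'} {y} {y'} (≈₃⇒≃ₚ x≈x') (≈₃⇒≃ₚ y≈y') = ≈₃⇒≃ₚ λ n →
  ∣-by (∣m∣n⇒∣m+n (x≈x' n) (y≈y' n)) (interchange (seq x n) (seq x' n) (seq y n) (seq y' n))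
  where
  interchange : ∀ a a' b b' → (a ℤ.- a') ℤ.+ (b ℤ.- b') ≡ (a ℤ.+ b) ℤ.- (a' ℤ.+ b')
  interchange = solve-∀

-ₚ-cong : ∀ {x x' y y'} → x ≃ₚ x' → y ≃ₚ y' → x -ₚ y ≃ₚ x' -ₚ y'
-ₚ-cong {x} {x'} {y} {y'} (≈₃⇒≃ₚ x≈x') (≈₃⇒≃ₚ y≈y') = ≈₃⇒≃ₚ λ n →
  ∣-by (∣m∣n⇒∣m-n (x≈x' n) (y≈y' n)) (interchange (seq x n) (seq x' n) (seq y n) (seq y' n))
  where
  interchange : ∀ a a' b b' → (a ℤ.- a') ℤ.- (b ℤ.- b') ≡ (a ℤ.- b) ℤ.- (a' ℤ.- b')
  interchange = solve-∀

*ₚ-cong : ∀ {x x' y y'} → x ≃ₚ x' → y ≃ₚ y' → x *ₚ y ≃ₚ x' *ₚ y'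
*ₚ-cong {x} {x'} {y} {y'} (≈₃⇒≃ₚ x≈x') (≈₃⇒≃ₚ y≈y') = ≈₃⇒≃ₚ λ n →
  ∣-by (∣m∣n⇒∣m+n (∣m⇒∣m*n (seq y n) (x≈x' n)) (∣n⇒∣m*n (seq x' n) (y≈y' n)))
       (product-diff (seq x n) (seq x' n) (seq y n) (seq y' n))
  where
  product-diff : ∀ a a' b b' → (a ℤ.- a') ℤ.* b ℤ.+ a' ℤ.* (b ℤ.- b') ≡ a ℤ.* b ℤ.- a' ℤ.* b'
  product-diff = solve-∀

3∣m-n⇒m≡n : ∀ {m n} → m ℕ.< 3 → n ℕ.< 3 → 3 ∣ + m ℤ.- + n → m ≡ n
3∣m-n⇒m≡n {0} {0} _ _ _ = refl
3∣m-n⇒m≡n {1} {1} _ _ _ = refl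
3∣m-n⇒m≡n {2} {2} _ _ _ = refl
3∣m-n⇒m≡n {0} {1} _ _ 3∣m-n = contradiction 3∣m-n (from-no (3 ∣? (0 ℤ.- 1)))
3∣m-n⇒m≡n {0} {2} _ _ 3∣m-n = contradiction 3∣m-n (from-no (3 ∣? (0 ℤ.- 2)))
3∣m-n⇒m≡n {1} {0} _ _ 3∣m-n = contradiction 3∣m-n (from-no (3 ∣? (1 ℤ.- 0)))
3∣m-n⇒m≡n {1} {2} _ _ 3∣m-n = contradiction 3∣m-n (from-no (3 ∣? (1 ℤ.- 2)))
3∣m-n⇒m≡n {2} {0} _ _ 3∣m-n = contradiction 3∣m-n (from-no (3 ∣? (2 ℤ.- 0)))
3∣m-n⇒m≡n {2} {1} _ _ 3∣m-n = contradiction 3∣m-n (from-no (3 ∣? (2 ℤ.- 1)))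
3∣m-n⇒m≡n {suc (suc (suc _))} (s≤s (s≤s (s≤s ())))
3∣m-n⇒m≡n {_} {suc (suc (suc _))} _ (s≤s (s≤s (s≤s ())))

%ℕ3-cong : ∀ a b → 3 ∣ a ℤ.- b → a %ℕ 3 ≡ b %ℕ 3
%ℕ3-cong a b 3∣a-b = 3∣m-n⇒m≡n (n%ℕd<d a 3) (n%ℕd<d b 3)
  (∣-by (∣m∣n⇒∣m-n 3∣a-b (divides (a /ℕ 3 ℤ.- b /ℕ 3) refl)) remainder-diff)
  where
  subtract-quotients : ∀ r q s p → ((r ℤ.+ q ℤ.* 3) ℤ.- (s ℤ.+ p ℤ.* 3)) ℤ.- (q ℤ.- p) ℤ.* 3 ≡ r ℤ.- s
  subtract-quotients = solve-∀
  remainder-diff : (a ℤ.- b) ℤ.- (a /ℕ 3 ℤ.- b /ℕ 3) ℤ.* 3 ≡ + (a %ℕ 3) ℤ.- + (b %ℕ 3)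
  remainder-diff = subst₂ (λ a' b' → (a' ℤ.- b') ℤ.- (a /ℕ 3 ℤ.- b /ℕ 3) ℤ.* 3 ≡ + (a %ℕ 3) ℤ.- + (b %ℕ 3))
    (≡.sym (a≡a%ℕn+[a/ℕn]*n a 3)) (≡.sym (a≡a%ℕn+[a/ℕn]*n b 3))
    (subtract-quotients (+ (a %ℕ 3)) (a /ℕ 3) (+ (b %ℕ 3)) (b /ℕ 3))

red-cong : ∀ x y → x ≈₃ y → red x ≡ red y
red-cong x y x≈y = cong (_mod 3) (%ℕ3-cong (seq x 1) (seq y 1) (x≈y 1))

module SquareRoot (c : ℤ) (3∣1+c : 3 ∣ 1 ℤ.+ c) where

  defect : ℤ → ℤ
  defect x = x ℤ.* x ℤ.+ c

  -- Newton's iteration for x² + c with the derivative 2x replaced by −1,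
  -- its value mod 3 at every iterate (they are all ≡ 1 mod 3).
  approx : ℕ → ℤ
  approx zero = 1
  approx (suc n) = approx n ℤ.+ defect (approx n)

  newton-step : ∀ n x → 3^ suc n ∣ defect x → 3 ∣ 1 ℤ.+ 2 ℤ.* x →
                3^ suc (suc n) ∣ defect (x ℤ.+ defect x) × 3 ∣ 1 ℤ.+ 2 ℤ.* (x ℤ.+ defect x)
  newton-step n x 3^∣y 3∣1+2x =
      ∣-by (∣m∣n⇒∣m+n (∣-trans 3^∣3y (*-monoʳ-∣ y 3∣1+2x)) (∣-trans 3^∣3y (*-monoʳ-∣ y 3∣y)))
           (≡.sym (defect-step x c))
    , ∣-by (∣m∣n⇒∣m+n 3∣1+2x (∣n⇒∣m*n 2 3∣y)) (≡.sym (derivative-step x c))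
    where
    y = defect x
    3∣y : 3 ∣ y
    3∣y = ∣-trans (3∣3^-suc n) 3^∣y
    3^∣3y : 3^ suc (suc n) ∣ y ℤ.* 3
    3^∣3y = subst (_∣ y ℤ.* 3) (≡.sym (3^-suc (suc n))) (*-monoˡ-∣ 3 3^∣y)
    defect-step : ∀ x c → (x ℤ.+ (x ℤ.* x ℤ.+ c)) ℤ.* (x ℤ.+ (x ℤ.* x ℤ.+ c)) ℤ.+ c
                ≡ (x ℤ.* x ℤ.+ c) ℤ.* (1 ℤ.+ 2 ℤ.* x) ℤ.+ (x ℤ.* x ℤ.+ c) ℤ.* (x ℤ.* x ℤ.+ c)
    defect-step = solve-∀
    derivative-step : ∀ x c → 1 ℤ.+ 2 ℤ.* (x ℤ.+ (x ℤ.* x ℤ.+ c)) ≡ (1 ℤ.+ 2 ℤ.* x) ℤ.+ 2 ℤ.* (x ℤ.* x ℤ.+ c)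
    derivative-step = solve-∀

  approx-invariant : ∀ n → 3^ suc n ∣ defect (approx n) × 3 ∣ 1 ℤ.+ 2 ℤ.* approx n
  approx-invariant zero = 3∣1+c , divides 1 refl
  approx-invariant (suc n) = uncurry (newton-step n (approx n)) (approx-invariant n)

  3^∣defect-approx : ∀ n → 3^ n ∣ defect (approx n)
  3^∣defect-approx n = ∣-trans (3^∣3^-suc n) (proj₁ (approx-invariant n))

  √-c : ℤ₃
  √-c = mkℤ₃ approx λ n → ∣-by (3^∣defect-approx n) (≡.sym (add-sub (approx n) c))
    where
    add-sub : ∀ x c → (x ℤ.+ (x ℤ.* x ℤ.+ c)) ℤ.- x ≡ x ℤ.* x ℤ.+ c
    add-sub = solve-∀

  √-c-squared : √-c *ₚ √-c ≃ₚ const (ℤ.- c)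
  √-c-squared = ≈₃⇒≃ₚ λ n → ∣-by (3^∣defect-approx n) (≡.sym (sub-neg (approx n) c))
    where
    sub-neg : ∀ x c → x ℤ.* x ℤ.- ℤ.- c ≡ x ℤ.* x ℤ.+ c
    sub-neg = solve-∀

module QuadraticIntegers (D : ℤ) where

  -- (p , q) stands for p + q√D
  ℤ[√D] : Set
  ℤ[√D] = ℤ × ℤ

  infix 4 _≟_
  _≟_ : DecidableEquality ℤ[√D]
  _≟_ = ≡-dec ℤ._≟_ ℤ._≟_

  infixl 6 _⊕_ _⊖_
  infixl 7 _⊗_
  _⊕_ _⊖_ _⊗_ : ℤ[√D] → ℤ[√D] → ℤ[√D]
  (p , q) ⊕ (p' , q') = (p ℤ.+ p' , q ℤ.+ q')
  (p , q) ⊖ (p' , q') = (p ℤ.- p' , q ℤ.- q')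
  (p , q) ⊗ (p' , q') = (p ℤ.* p' ℤ.+ D ℤ.* q ℤ.* q' , p ℤ.* q' ℤ.+ q ℤ.* p')

  infixl 7 _·_
  _·_ : M2 ℤ[√D] → M2 ℤ[√D] → M2 ℤ[√D]
  mat a b c d · mat a' b' c' d' =
    mat (a ⊗ a' ⊕ b ⊗ c') (a ⊗ b' ⊕ b ⊗ d')
        (c ⊗ a' ⊕ d ⊗ c') (c ⊗ b' ⊕ d ⊗ d')

  det : M2 ℤ[√D] → ℤ[√D]
  det (mat a b c d) = a ⊗ d ⊖ b ⊗ c

  module Evaluation (r : ℤ₃) (r²≃D : r *ₚ r ≃ₚ const D) where

    ev : ℤ[√D] → ℤ₃
    ev (p , q) = const p +ₚ const q *ₚ r

    ev-1 : ev (1 , 0) ≃ₚ 1ₚ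
    ev-1 = seq-≡⇒≃ₚ λ n → unit (seq r n)
      where
      unit : ∀ x → 1 ℤ.+ 0 ℤ.* x ≡ 1
      unit = solve-∀

    ev-⊕ : ∀ x y → ev x +ₚ ev y ≃ₚ ev (x ⊕ y)
    ev-⊕ (p , q) (p' , q') = seq-≡⇒≃ₚ λ n → collect p q p' q' (seq r n)
      where
      collect : ∀ p q p' q' x → (p ℤ.+ q ℤ.* x) ℤ.+ (p' ℤ.+ q' ℤ.* x) ≡ (p ℤ.+ p') ℤ.+ (q ℤ.+ q') ℤ.* x
      collect = solve-∀

    ev-⊖ : ∀ x y → ev x -ₚ ev y ≃ₚ ev (x ⊖ y)
    ev-⊖ (p , q) (p' , q') = seq-≡⇒≃ₚ λ n → collect p q p' q' (seq r n)
      where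
      collect : ∀ p q p' q' x → (p ℤ.+ q ℤ.* x) ℤ.- (p' ℤ.+ q' ℤ.* x) ≡ (p ℤ.- p') ℤ.+ (q ℤ.- q') ℤ.* x
      collect = solve-∀

    ev-⊗ : ∀ x y → ev x *ₚ ev y ≃ₚ ev (x ⊗ y)
    ev-⊗ (p , q) (p' , q') = ≈₃⇒≃ₚ λ n →
      ∣-by (∣n⇒∣m*n (q ℤ.* q') (≃ₚ⇒≈₃ r²≃D n)) (≡.sym (product-diff D p q p' q' (seq r n)))
      where
      product-diff : ∀ D p q p' q' x →
        (p ℤ.+ q ℤ.* x) ℤ.* (p' ℤ.+ q' ℤ.* x) ℤ.- ((p ℤ.* p' ℤ.+ D ℤ.* q ℤ.* q') ℤ.+ (p ℤ.* q' ℤ.+ q ℤ.* p') ℤ.* x)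
        ≡ (q ℤ.* q') ℤ.* (x ℤ.* x ℤ.- D)
      product-diff = solve-∀

    ev-· : ∀ X Y → map2 ev (X · Y) ≈ₘ (map2 ev X ·ₚ map2 ev Y)
    ev-· (mat a b c d) (mat a' b' c' d') =
        entry a a' b c' , entry a b' b d' , entry c a' d c' , entry c b' d d'
      where
      entry : ∀ u v w z → ev (u ⊗ v ⊕ w ⊗ z) ≈₃ ev u *ₚ ev v +ₚ ev w *ₚ ev z
      entry u v w z = ≃ₚ⇒≈₃ (≃ₚ-sym (≃ₚ-trans (+ₚ-cong (ev-⊗ u v) (ev-⊗ w z)) (ev-⊕ (u ⊗ v) (w ⊗ z))))

    ev-inverse : ∀ {x} u v → x ≃ₚ ev u → u ⊗ v ≡ (1 , 0) → x *ₚ ev v ≃ₚ 1ₚ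
    ev-inverse {x} u v x≃u uv≡1 =
      ≃ₚ-trans (*ₚ-cong {x} {ev u} {ev v} {ev v} x≃u ≃ₚ-refl) (≃ₚ-trans (ev-⊗ u v) (≃ₚ-trans (≡⇒≃ₚ (cong ev uv≡1)) ev-1))

    -- The detour through _≈₃_ compares only the sequences: matching
    -- detₚ (map2 ev (mat a b c d)) against its unfolding as ℤ₃ values would
    -- also compare their coherence proofs, which is prohibitively slow.
    ev-det : ∀ X → detₚ (map2 ev X) ≃ₚ ev (det X)
    ev-det (mat a b c d) =
      ≈₃⇒≃ₚ (≃ₚ⇒≈₃ (≃ₚ-trans (-ₚ-cong (ev-⊗ a d) (ev-⊗ b c)) (ev-⊖ (a ⊗ d) (b ⊗ c))))

M2-≟ : ∀ {A : Set} → DecidableEquality A → DecidableEquality (M2 A)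
M2-≟ _≟_ (mat a b c d) (mat a' b' c' d') =
  map′ (λ { (refl , refl , refl , refl) → refl }) (λ { refl → refl , refl , refl , refl })
       (a ≟ a' ×-dec b ≟ b' ×-dec c ≟ c' ×-dec d ≟ d')

all-M2? : ∀ {n} {P : M2 (Fin n) → Set} → Decidable P → Dec (∀ m → P m)
all-M2? P? = map′ (λ ∀P → λ { (mat a b c d) → ∀P a b c d }) (λ ∀P a b c d → ∀P (mat a b c d))
  (all? λ a → all? λ b → all? λ c → all? λ d → P? (mat a b c d))

π-cong : ∀ X Y → X ≈ₘ Y → π X ≡ π Y
π-cong (mat a b c d) (mat a' b' c' d') (a≈a' , b≈b' , c≈c' , d≈d')
  rewrite red-cong a a' a≈a' | red-cong b b' b≈b' | red-cong c c' c≈c' | red-cong d d' d≈d' = refl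

open SquareRoot 2 (divides 1 refl) using () renaming (√-c to √-2; √-c-squared to √-2-squared)
open QuadraticIntegers -2 renaming (ℤ[√D] to ℤ[√-2])
open Evaluation √-2 √-2-squared

-- (p , q) = p + q√-2 reduces to p + q mod 3, since the chosen √-2 is ≡ 1.
-- Matrices not listed, among them all singular ones, are lifted entrywise.
lift : M2 𝔽₃ → M2 ℤ[√-2]
lift (mat 0F 1F 1F 0F) = mat (-1 , 1) (-2 , 0) (-1 , -1) (1 , -1)
lift (mat 0F 1F 1F 1F) = mat (0 , 0) (1 , 0) (1 , 0) (0 , 1)
lift (mat 0F 1F 1F 2F) = mat (1 , -1) (1 , 0) (0 , 1) (-1 , 0)
lift (mat 0F 1F 2F 0F) = mat (-1 , 1) (-2 , 0) (0 , -1) (1 , -1)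
lift (mat 0F 1F 2F 1F) = mat (1 , -1) (1 , 0) (1 , 1) (0 , 1)
lift (mat 0F 1F 2F 2F) = mat (0 , 0) (1 , 0) (-1 , 0) (-1 , 0)
lift (mat 0F 2F 1F 0F) = mat (1 , -1) (2 , 0) (0 , 1) (-1 , 1)
lift (mat 0F 2F 1F 1F) = mat (0 , 0) (-1 , 0) (1 , 0) (1 , 0)
lift (mat 0F 2F 1F 2F) = mat (-1 , 1) (-1 , 0) (-1 , -1) (0 , -1)
lift (mat 0F 2F 2F 0F) = mat (1 , -1) (2 , 0) (1 , 1) (-1 , 1)
lift (mat 0F 2F 2F 1F) = mat (-1 , 1) (-1 , 0) (0 , -1) (1 , 0)
lift (mat 0F 2F 2F 2F) = mat (0 , 0) (-1 , 0) (-1 , 0) (0 , -1)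
lift (mat 1F 0F 0F 2F) = mat (1 , 0) (0 , 0) (-1 , 1) (-1 , 0)
lift (mat 1F 0F 1F 1F) = mat (-1 , -1) (1 , -1) (1 , 0) (0 , 1)
lift (mat 1F 0F 1F 2F) = mat (0 , 1) (-1 , 1) (-1 , -1) (0 , -1)
lift (mat 1F 0F 2F 1F) = mat (0 , 1) (-1 , 1) (-1 , 0) (-1 , -1)
lift (mat 1F 0F 2F 2F) = mat (-1 , -1) (1 , -1) (2 , 0) (1 , 1)
lift (mat 1F 1F 0F 1F) = mat (-2 , 0) (-1 , -1) (1 , -1) (1 , 0)
lift (mat 1F 1F 0F 2F) = mat (-2 , 0) (-1 , -1) (1 , -1) (2 , 0)
lift (mat 1F 1F 1F 0F) = mat (1 , 0) (1 , 0) (0 , 1) (-1 , 1)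
lift (mat 1F 1F 1F 2F) = mat (1 , 0) (0 , 1) (0 , 1) (-1 , 0)
lift (mat 1F 1F 2F 0F) = mat (1 , 0) (1 , 0) (-1 , 0) (0 , 0)
lift (mat 1F 1F 2F 1F) = mat (1 , 0) (0 , 1) (-1 , 0) (-1 , -1)
lift (mat 1F 2F 0F 1F) = mat (1 , 0) (1 , 1) (-1 , 1) (-2 , 0)
lift (mat 1F 2F 0F 2F) = mat (1 , 0) (1 , 1) (0 , 0) (-1 , 0)
lift (mat 1F 2F 1F 0F) = mat (0 , 1) (-1 , 0) (-1 , -1) (1 , -1)
lift (mat 1F 2F 1F 1F) = mat (-1 , -1) (0 , -1) (1 , 0) (1 , 0)
lift (mat 1F 2F 2F 0F) = mat (0 , 1) (-1 , 0) (-1 , 0) (0 , 0)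
lift (mat 1F 2F 2F 2F) = mat (-1 , -1) (0 , -1) (2 , 0) (1 , 1)
lift (mat 2F 0F 0F 1F) = mat (-1 , 0) (0 , 0) (1 , -1) (1 , 0)
lift (mat 2F 0F 0F 2F) = mat (-1 , 0) (0 , 0) (0 , 0) (-1 , 0)
lift (mat 2F 0F 1F 1F) = mat (1 , 1) (-1 , 1) (-2 , 0) (-1 , -1)
lift (mat 2F 0F 1F 2F) = mat (0 , -1) (1 , -1) (1 , 0) (1 , 1)
lift (mat 2F 0F 2F 1F) = mat (0 , -1) (1 , -1) (1 , 1) (0 , 1)
lift (mat 2F 0F 2F 2F) = mat (1 , 1) (-1 , 1) (-1 , 0) (0 , -1)
lift (mat 2F 1F 0F 1F) = mat (-1 , 0) (-1 , -1) (0 , 0) (1 , 0)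
lift (mat 2F 1F 0F 2F) = mat (-1 , 0) (-1 , -1) (1 , -1) (2 , 0)
lift (mat 2F 1F 1F 0F) = mat (0 , -1) (1 , 0) (1 , 0) (0 , 0)
lift (mat 2F 1F 1F 1F) = mat (1 , 1) (0 , 1) (-2 , 0) (-1 , -1)
lift (mat 2F 1F 2F 0F) = mat (0 , -1) (1 , 0) (1 , 1) (-1 , 1)
lift (mat 2F 1F 2F 2F) = mat (1 , 1) (0 , 1) (-1 , 0) (-1 , 0)
lift (mat 2F 2F 0F 1F) = mat (2 , 0) (1 , 1) (-1 , 1) (-2 , 0)
lift (mat 2F 2F 0F 2F) = mat (2 , 0) (1 , 1) (-1 , 1) (-1 , 0)
lift (mat 2F 2F 1F 0F) = mat (-1 , 0) (-1 , 0) (1 , 0) (0 , 0)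
lift (mat 2F 2F 1F 2F) = mat (-1 , 0) (0 , -1) (1 , 0) (1 , 1)
lift (mat 2F 2F 2F 0F) = mat (-1 , 0) (-1 , 0) (0 , -1) (1 , -1)
lift (mat 2F 2F 2F 1F) = mat (-1 , 0) (0 , -1) (0 , -1) (1 , 0)
lift m = map2 (λ x → (+ toℕ x , 0)) m

lift-· : ∀ g h → det₃ g ≢ 0F → det₃ h ≢ 0F → lift (g ·₃ h) ≡ lift g · lift h
lift-· = from-yes (all-M2? λ g → all-M2? λ h →
  ¬? (det₃ g Fin.≟ 0F) →-dec ¬? (det₃ h Fin.≟ 0F) →-dec M2-≟ _≟_ (lift (g ·₃ h)) (lift g · lift h))

det-lift-SL : ∀ g → det₃ g ≡ 1F → det (lift g) ≡ (1 , 0)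
det-lift-SL = from-yes (all-M2? λ g → det₃ g Fin.≟ 1F →-dec det (lift g) ≟ (1 , 0))

det-lift-GL : ∀ g → det₃ g ≢ 0F → det (lift g) ⊗ det (lift g) ≡ (1 , 0)
det-lift-GL = from-yes (all-M2? λ g → ¬? (det₃ g Fin.≟ 0F) →-dec det (lift g) ⊗ det (lift g) ≟ (1 , 0))

π-ev-lift : ∀ g → π (map2 ev (lift g)) ≡ g
π-ev-lift = from-yes (all-M2? λ g → M2-≟ Fin._≟_ (π (map2 ev (lift g))) g)

β : M2 𝔽₃ → M2 ℤ₃
β g = map2 ev (lift g)

β-· : ∀ g h → det₃ g ≢ 0F → det₃ h ≢ 0F → β (g ·₃ h) ≈ₘ (β g ·ₚ β h)
β-· g h g-invertible h-invertible =
  subst (λ X → map2 ev X ≈ₘ (β g ·ₚ β h)) (≡.sym (lift-· g h g-invertible h-invertible)) (ev-· (lift g) (lift h))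

β-injective : ∀ g h → β g ≈ₘ β h → g ≡ h
β-injective g h βg≈βh = begin
  g               ≡⟨ π-ev-lift g ⟨
  π (β g)         ≡⟨ π-cong (β g) (β h) βg≈βh ⟩
  π (β h)         ≡⟨ π-ev-lift h ⟩
  h               ∎
  where open ≡.≡-Reasoning

β-SL : ∀ g → det₃ g ≡ 1F → InSL2Z3 (β g)
β-SL g det≡1 = ≃ₚ⇒≈₃ (≃ₚ-trans (ev-det (lift g)) (≃ₚ-trans (≡⇒≃ₚ (cong ev (det-lift-SL g det≡1))) ev-1))

β-GL : ∀ g → det₃ g ≢ 0F → InGL2Z3 (β g)
β-GL g det≢0 = ev D , ≃ₚ⇒≈₃ (ev-inverse D D (ev-det (lift g)) (det-lift-GL g det≢0))
  where D = det (lift g)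

splitting : ∀ {P : M2 𝔽₃ → Set} {InH : M2 ℤ₃ → Set} →
            (∀ g → P g → det₃ g ≢ 0F) → (∀ g → P g → InH (β g)) →
            SplittingHom {P} InH (λ g → β (proj₁ g))
splitting invertible lands = record
  { lands     = λ (g , Pg) → lands g Pg
  ; hom       = λ { (g , Pg) (h , Ph) _ refl → β-· g h (invertible g Pg) (invertible h Ph) }
  ; injective = λ (g , _) (h , _) → β-injective g h
  ; section   = λ (g , _) → π-ev-lift g
  }

lemma2p12 : Σ (SL2F3 → M2 ℤ₃) (SplittingHom InSL2Z3)
    × Σ (GL2F3 → M2 ℤ₃) (SplittingHom InGL2Z3)
lemma2p12 = (_ , splitting (λ _ det≡1 det≡0 → 0≢1+n (≡.trans (≡.sym det≡0) det≡1)) β-SL)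
          , (_ , splitting (λ _ det≢0 → det≢0) β-GL)
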